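{- Let $C$ be an $(X,s)$-neighbour transitive code in $H(m,q)$ with minimum distance $\delta$. Then for each $i\le\min\{s,\lfloor\frac{\delta-1}{2}\rfloor\}$ and each $i$-subset $I$ of the entry set $M$, the setwise stabiliser $X_I$ of $I$ (under the action of $X$ on $M$) acts transitively on $C$.
   Context: The Hamming graph $H(m,q)$ has vertices the $m$-tuples over an alphabet $Q$ ($|Q|=q\ge2$) indexed by an entry set $M$ ($|M|=m$), adjacent iff differing in one entry. $\mathrm{Aut}(H(m,q))=N\rtimes L$, $N\cong S_q^m$ acting entrywise, $L\cong S_m$ permuting entries; a subgroup $X$ acts on $M$ via $(h_1,\dots,h_m)\sigma\mapsto\sigma$. For a code $C$ (set of vertices, $|C|\ge2$), $\delta$ is its minimum distance, $C_i$ the set of vertices at distance exactly $i$ from $C$, $\mathrm{Aut}(C)$ its setwise stabiliser. For $X\le\mathrm{Aut}(C)$, $C$ is $(X,s)$-neighbour transitive if $X$ is transitive on each of $C,C_1,\dots,C_s$. -}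

module Defs where

open import Data.Nat using (ℕ; zero; suc; _≤_)
open import Data.Fin using (Fin; _≟_)
open import Data.Fin.Subset using (Subset; _∈_)
open import Data.Fin.Permutation using (Permutation′; _⟨$⟩ʳ_; _⟨$⟩ˡ_; _∘ₚ_; flip)
open import Data.Vec using (Vec; lookup; tabulate)
open import Data.List using (List; map; allFin)
open import Data.Nat.ListAction using (sum)
open import Data.Bool using (if_then_else_)
open import Data.Product using (Σ; ∃; _×_; _,_)
open import Relation.Nullary using (¬_)
open import Relation.Nullary.Decidable using (⌊_⌋)
open import Relation.Binary.PropositionalEquality using (_≡_)
open import Function.Bundles using (_⇔_)

-- Vertices of H(m,q): m-tuples over the alphabet Q = Fin q, entry set M = Fin m.
Word : ℕ → ℕ → Set
Word m q = Vec (Fin q) m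

dist : ∀ {m q} → Word m q → Word m q → ℕ
dist {m} α β = sum (map (λ j → if ⌊ lookup α j ≟ lookup β j ⌋ then 0 else 1) (allFin m))

Code : ℕ → ℕ → Set₁
Code m q = Word m q → Set

-- Elements of Aut(H(m,q)) = N ⋊ L: x = (h_1,…,h_m) σ with h_j ∈ Sym(Q), σ ∈ Sym(M).
record Aut (m q : ℕ) : Set where
  constructor _▹_
  field
    h : Fin m → Permutation′ q
    σ : Permutation′ m
open Aut public

-- Right action on vertices:  α^{(h_1,…,h_m)σ} is the word whose entry in position jσ
-- is (α_j)^{h_j}; i.e. entry k of the image is (α_{kσ⁻¹})^{h_{kσ⁻¹}}.
_·_ : ∀ {m q} → Word m q → Aut m q → Word m q
α · x = tabulate (λ k → h x (σ x ⟨$⟩ˡ k) ⟨$⟩ʳ lookup α (σ x ⟨$⟩ˡ k))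

-- Group operations (product xy = "first x, then y"), compatible with _·_.
idA : ∀ {m q} → Aut m q
idA = (λ _ → Data.Fin.Permutation.id) ▹ Data.Fin.Permutation.id

_⊙_ : ∀ {m q} → Aut m q → Aut m q → Aut m q
x ⊙ y = (λ i → h x i ∘ₚ h y (σ x ⟨$⟩ʳ i)) ▹ (σ x ∘ₚ σ y)

invA : ∀ {m q} → Aut m q → Aut m q
invA x = (λ i → flip (h x (σ x ⟨$⟩ˡ i))) ▹ flip (σ x)

record Subgroup (m q : ℕ) : Set₁ where
  field
    _∈X : Aut m q → Set
    id-closed  : idA ∈X
    ⊙-closed   : ∀ {x y} → x ∈X → y ∈X → (x ⊙ y) ∈X
    inv-closed : ∀ {x} → x ∈X → invA x ∈X
open Subgroup public

StabilisesCode : ∀ {m q} → Subgroup m q → Code m q → Set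
StabilisesCode X C = ∀ x → _∈X X x → ∀ α → (C α → C (α · x)) × (C (α · x) → C α)

AtLeastTwo : ∀ {m q} → Code m q → Set
AtLeastTwo C = Σ _ λ α → Σ _ λ β → C α × C β × ¬ (α ≡ β)

IsMinDist : ∀ {m q} → Code m q → ℕ → Set
IsMinDist C δ =
  (Σ _ λ α → Σ _ λ β → C α × C β × ¬ (α ≡ β) × dist α β ≡ δ)
  × (∀ α β → C α → C β → ¬ (α ≡ β) → δ ≤ dist α β)

-- C_i : vertices at distance exactly i from C (d(ν,C) = min over c ∈ C of d(ν,c)).
DistSet : ∀ {m q} → Code m q → ℕ → Word m q → Set
DistSet C i ν = (Σ _ λ c → C c × dist ν c ≡ i) × (∀ c → C c → i ≤ dist ν c)

TransitiveOn : ∀ {m q} → (Aut m q → Set) → (Word m q → Set) → Set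
TransitiveOn Y S = ∀ α β → S α → S β → Σ _ λ x → Y x × (α · x ≡ β)

NeighbourTransitive : ∀ {m q} → Subgroup m q → ℕ → Code m q → Set
NeighbourTransitive X s C =
  StabilisesCode X C
  × TransitiveOn (_∈X X) C
  × (∀ i → 1 ≤ i → i ≤ s → TransitiveOn (_∈X X) (DistSet C i))

InSetStab : ∀ {m q} → Subgroup m q → Subset m → Aut m q → Set
InSetStab X I x = _∈X X x × (∀ j → (j ∈ I) ⇔ ((σ x ⟨$⟩ʳ j) ∈ I))

-- For a codeword γ let ν_γ be γ with every entry in I changed (q ≥ 2).
-- Then d(ν_γ, γ) = i, and since 2i < δ the word γ is the unique codeword within
-- distance i of ν_γ; hence ν_γ ∈ C_i.  Given α, β ∈ C, transitivity of X on C_i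
-- yields x ∈ X with ν_α^x = ν_β.  As x is an isometry preserving C, α^x is a
-- codeword within distance i of ν_β, so α^x = β.  Finally x carries the set of
-- entries where ν_α and α differ, namely I, onto the set where ν_β and β differ,
-- again I; so x ∈ X_I.  (For i = 0, I is empty and X_I = X.)
module Submission where

open import Defs
open import Data.Nat using (ℕ; _≤_; _⊓_; _∸_; _/_)
open import Data.Fin.Subset using (Subset; ∣_∣)
open import Relation.Binary.PropositionalEquality using (_≡_)

open import Data.Nat using (zero; suc; _+_; _*_; _<_; z≤n; s≤s; _≤?_)
open import Data.Nat.Properties as ℕ
  using (≤-trans; +-mono-≤; ≰⇒>; ≤⇒≯; <-irrefl; n≮0; m≤m+n; m≤n⊓o⇒m≤n; m≤n⊓o⇒m≤o)
open import Data.Nat.DivMod using (m/n*n≤m)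
open import Data.Nat.ListAction using (sum)
open import Data.Fin as Fin using (Fin; zero; suc)
open import Data.Fin.Subset using (_∈_; _-_)
open import Data.Fin.Subset.Properties using (x∈p⇒∣p-x∣<∣p∣)
open import Data.Fin.Permutation as Perm using (Permutation′; _⟨$⟩ʳ_; _⟨$⟩ˡ_; inverseˡ)
open import Data.Vec using (lookup; tabulate; _∷_; [])
open import Data.Vec.Properties using (lookup∘tabulate; ≡-dec; []=⇒lookup; lookup⇒[]=)
import Data.List as List
open import Data.List.Properties using (map-tabulate)
open import Data.Bool using (true; false; if_then_else_)
open import Data.Product using (_,_)
open import Data.Empty using (⊥; ⊥-elim)
open import Relation.Nullary using (¬_; yes; no)
open import Relation.Nullary.Decidable using (⌊_⌋)
open import Relation.Binary.PropositionalEquality using (_≢_; refl; sym; trans; cong; cong₂; subst; subst₂)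
open import Function.Bundles using (_⇔_; mk⇔)
import Function.Properties.Equivalence as ⇔
open import Algebra.Properties.CommutativeMonoid.Sum ℕ.+-0-commutativeMonoid
  using (∑-distrib-+; sum-cong-≗; sum-permute)
  renaming (sum to ∑)

differ : ∀ {q} → Fin q → Fin q → ℕ
differ a b = if ⌊ a Fin.≟ b ⌋ then 0 else 1

differ-≡ : ∀ {q} {a b : Fin q} → a ≡ b → differ a b ≡ 0
differ-≡ {a = a} {b} a≡b with a Fin.≟ b
... | yes _   = refl
... | no a≢b = ⊥-elim (a≢b a≡b)

differ-≢ : ∀ {q} {a b : Fin q} → a ≢ b → differ a b ≡ 1
differ-≢ {a = a} {b} a≢b with a Fin.≟ b
... | yes a≡b = ⊥-elim (a≢b a≡b)
... | no _    = refl

sum-tabulate : ∀ {n} (f : Fin n → ℕ) → sum (List.tabulate f) ≡ ∑ f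
sum-tabulate {zero}  f = refl
sum-tabulate {suc n} f = cong (f zero +_) (sum-tabulate (λ j → f (suc j)))

dist-as-∑ : ∀ {m q} (α β : Word m q) → dist α β ≡ ∑ (λ j → differ (lookup α j) (lookup β j))
dist-as-∑ {m} α β = trans (cong sum (map-tabulate {n = m} (λ j → j) f)) (sum-tabulate f)
  where
  f : Fin m → ℕ
  f j = differ (lookup α j) (lookup β j)

∑-mono : ∀ {n} {f g : Fin n → ℕ} → (∀ j → f j ≤ g j) → ∑ f ≤ ∑ g
∑-mono {zero}  f≤g = z≤n
∑-mono {suc n} f≤g = +-mono-≤ (f≤g zero) (∑-mono (λ j → f≤g (suc j)))

differ-sym : ∀ {q} (a b : Fin q) → differ a b ≡ differ b a
differ-sym a b with a Fin.≟ b
... | yes a≡b = sym (differ-≡ (sym a≡b))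
... | no a≢b  = sym (differ-≢ (λ b≡a → a≢b (sym b≡a)))

differ-triangle : ∀ {q} (a b c : Fin q) → differ a c ≤ differ a b + differ b c
differ-triangle a b c with a Fin.≟ c | a Fin.≟ b | b Fin.≟ c
... | yes _ | _       | _       = z≤n
... | no _  | no _    | _       = s≤s z≤n
... | no _  | yes _   | no _    = s≤s z≤n
... | no a≢c | yes a≡b | yes b≡c = ⊥-elim (a≢c (trans a≡b b≡c))

dist-sym : ∀ {m q} (α β : Word m q) → dist α β ≡ dist β α
dist-sym α β = begin
  dist α β                                      ≡⟨ dist-as-∑ α β ⟩
  ∑ (λ j → differ (lookup α j) (lookup β j))   ≡⟨ sum-cong-≗ (λ j → differ-sym (lookup α j) (lookup β j)) ⟩
  ∑ (λ j → differ (lookup β j) (lookup α j))   ≡⟨ sym (dist-as-∑ β α) ⟩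
  dist β α                                      ∎
  where open Relation.Binary.PropositionalEquality.≡-Reasoning

dist-triangle : ∀ {m q} (α β γ : Word m q) → dist α γ ≤ dist α β + dist β γ
dist-triangle {m} {q} α β γ = begin
  dist α γ                                        ≡⟨ dist-as-∑ α γ ⟩
  ∑ (λ j → differ (α ! j) (γ ! j))               ≤⟨ ∑-mono (λ j → differ-triangle (α ! j) (β ! j) (γ ! j)) ⟩
  ∑ (λ j → differ (α ! j) (β ! j) + differ (β ! j) (γ ! j))
                                                  ≡⟨ ∑-distrib-+ (λ j → differ (α ! j) (β ! j)) (λ j → differ (β ! j) (γ ! j)) ⟩
  ∑ (λ j → differ (α ! j) (β ! j)) + ∑ (λ j → differ (β ! j) (γ ! j))
                                                  ≡⟨ sym (cong₂ _+_ (dist-as-∑ α β) (dist-as-∑ β γ)) ⟩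
  dist α β + dist β γ                             ∎
  where
  open ℕ.≤-Reasoning
  _!_ : Word m q → Fin m → Fin q
  _!_ = lookup

perm-injective : ∀ {q} (π : Permutation′ q) {a b} → π ⟨$⟩ʳ a ≡ π ⟨$⟩ʳ b → a ≡ b
perm-injective π πa≡πb = trans (sym (inverseˡ π)) (trans (cong (π ⟨$⟩ˡ_) πa≡πb) (inverseˡ π))

differ-perm : ∀ {q} (π : Permutation′ q) (a b : Fin q) → differ (π ⟨$⟩ʳ a) (π ⟨$⟩ʳ b) ≡ differ a b
differ-perm π a b with a Fin.≟ b
... | yes a≡b = differ-≡ (cong (π ⟨$⟩ʳ_) a≡b)
... | no a≢b  = differ-≢ (λ πa≡πb → a≢b (perm-injective π πa≡πb))

lookup-act : ∀ {m q} (γ : Word m q) (x : Aut m q) k →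
  lookup (γ · x) k ≡ h x (σ x ⟨$⟩ˡ k) ⟨$⟩ʳ lookup γ (σ x ⟨$⟩ˡ k)
lookup-act γ x k = lookup∘tabulate _ k

lookup-act-σ : ∀ {m q} (γ : Word m q) (x : Aut m q) j →
  lookup (γ · x) (σ x ⟨$⟩ʳ j) ≡ h x j ⟨$⟩ʳ lookup γ j
lookup-act-σ γ x j rewrite lookup-act γ x (σ x ⟨$⟩ʳ j) | inverseˡ (σ x) {j} = refl

-- Each entry contributes as before, reindexed by σ⁻¹; the sum is permutation invariant.
dist-invariant : ∀ {m q} (α β : Word m q) (x : Aut m q) → dist (α · x) (β · x) ≡ dist α β
dist-invariant {m} α β x = begin
  dist (α · x) (β · x)                              ≡⟨ dist-as-∑ (α · x) (β · x) ⟩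
  ∑ (λ k → differ (lookup (α · x) k) (lookup (β · x) k)) ≡⟨ sum-cong-≗ entrywise ⟩
  ∑ (λ k → g (σ x ⟨$⟩ˡ k))                          ≡⟨ sym (sum-permute g (Perm.flip (σ x))) ⟩
  ∑ g                                               ≡⟨ sym (dist-as-∑ α β) ⟩
  dist α β                                          ∎
  where
  open Relation.Binary.PropositionalEquality.≡-Reasoning
  g : Fin m → ℕ
  g j = differ (lookup α j) (lookup β j)
  entrywise : ∀ k → differ (lookup (α · x) k) (lookup (β · x) k) ≡ g (σ x ⟨$⟩ˡ k)
  entrywise k rewrite lookup-act α x k | lookup-act β x k =
    differ-perm (h x (σ x ⟨$⟩ˡ k)) (lookup α (σ x ⟨$⟩ˡ k)) (lookup β (σ x ⟨$⟩ˡ k))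

difference-transport : ∀ {m q} (x : Aut m q) (ν α : Word m q) j →
  (lookup ν j ≢ lookup α j) ⇔ (lookup (ν · x) (σ x ⟨$⟩ʳ j) ≢ lookup (α · x) (σ x ⟨$⟩ʳ j))
difference-transport x ν α j = mk⇔
  (λ ν≢α e → ν≢α (perm-injective (h x j)
     (trans (sym (lookup-act-σ ν x j)) (trans e (lookup-act-σ α x j)))))
  (λ νx≢αx e → νx≢αx
     (trans (lookup-act-σ ν x j) (trans (cong (h x j ⟨$⟩ʳ_) e) (sym (lookup-act-σ α x j)))))

MinDistBound : ∀ {m q} → Code m q → ℕ → Set
MinDistBound C δ = ∀ α β → C α → C β → ¬ (α ≡ β) → δ ≤ dist α β

packing-gap : ∀ {i δ} → 1 ≤ i → i ≤ (δ ∸ 1) / 2 → i + i < δ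
packing-gap {i} {δ} 1≤i i≤ = below-pred (≤-trans 1≤i (m≤m+n i i)) (begin
  i + i                 ≡⟨ cong (i +_) (sym (ℕ.+-identityʳ i)) ⟩
  2 * i                 ≤⟨ ℕ.*-monoʳ-≤ 2 i≤ ⟩
  2 * ((δ ∸ 1) / 2)     ≡⟨ ℕ.*-comm 2 ((δ ∸ 1) / 2) ⟩
  ((δ ∸ 1) / 2) * 2     ≤⟨ m/n*n≤m (δ ∸ 1) 2 ⟩
  δ ∸ 1                 ∎)
  where
  open ℕ.≤-Reasoning
  below-pred : ∀ {n d} → 1 ≤ n → n ≤ d ∸ 1 → n < d
  below-pred {d = suc _} _       n≤ = s≤s n≤
  below-pred {d = zero}  (s≤s _) ()

nearest-codeword-unique : ∀ {m q} {C : Code m q} {δ i} → MinDistBound C δ → i + i < δ →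
  ∀ {c d} w → C c → C d → dist w c ≤ i → dist w d ≤ i → c ≡ d
nearest-codeword-unique {i = i} minDist 2i<δ {c} {d} w Cc Cd wc≤i wd≤i with ≡-dec Fin._≟_ c d
... | yes c≡d = c≡d
... | no c≢d  = ⊥-elim (≤⇒≯ (minDist c d Cc Cd c≢d) (ℕ.≤-<-trans cd≤2i 2i<δ))
  where
  cd≤2i : dist c d ≤ i + i
  cd≤2i = ≤-trans (dist-triangle c w d) (+-mono-≤ (subst (_≤ i) (dist-sym w c) wc≤i) wd≤i)

within-packing⇒DistSet : ∀ {m q} {C : Code m q} {δ i} → MinDistBound C δ → i + i < δ →
  ∀ {γ} ν → C γ → dist ν γ ≡ i → DistSet C i ν
within-packing⇒DistSet {C = C} {i = i} minDist 2i<δ {γ} ν Cγ νγ≡i = (γ , Cγ , νγ≡i) , bound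
  where
  bound : ∀ c → C c → i ≤ dist ν c
  bound c Cc with i ≤? dist ν c
  ... | yes i≤νc = i≤νc
  ... | no i≰νc  = ⊥-elim (<-irrefl (sym (trans (sym νγ≡i) (cong (dist ν) γ≡c))) νc<i)
    where
    νc<i : dist ν c < i
    νc<i = ≰⇒> i≰νc
    γ≡c : γ ≡ c
    γ≡c = nearest-codeword-unique minDist 2i<δ ν Cγ Cc (ℕ.≤-reflexive νγ≡i) (ℕ.<⇒≤ νc<i)

nearest-codeword-equivariant : ∀ {m q} {X : Subgroup m q} {C : Code m q} {δ i} →
  StabilisesCode X C → MinDistBound C δ → i + i < δ →
  ∀ {x} → _∈X X x → ∀ {α β} → C α → C β → ∀ ν μ → dist ν α ≤ i → dist μ β ≤ i →
  ν · x ≡ μ → α · x ≡ β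
nearest-codeword-equivariant {C = C} {i = i} stab minDist 2i<δ {x} x∈X {α} {β} Cα Cβ ν μ να≤i μβ≤i νx≡μ =
  nearest-codeword-unique minDist 2i<δ μ Cαx Cβ (subst (_≤ i) (sym μαx≡να) να≤i) μβ≤i
  where
  Cαx : C (α · x)
  Cαx = let (preserve , _) = stab x x∈X α in preserve Cα
  μαx≡να : dist μ (α · x) ≡ dist ν α
  μαx≡να = trans (cong (λ w → dist w (α · x)) (sym νx≡μ)) (dist-invariant ν α x)

-- Perturbing the entries in I.  Since q ≥ 2, every symbol has a different one.
other : ∀ {q} → Fin (suc (suc q)) → Fin (suc (suc q))
other zero    = suc zero
other (suc _) = zero

other-≢ : ∀ {q} (a : Fin (suc (suc q))) → other a ≢ a
other-≢ zero    ()
other-≢ (suc _) ()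

perturb : ∀ {m q} → Subset m → Word m (suc (suc q)) → Word m (suc (suc q))
perturb I γ = tabulate (λ j → if lookup I j then other (lookup γ j) else lookup γ j)

module _ {m q} (I : Subset m) (γ : Word m (suc (suc q))) where

  lookup-perturb : ∀ j → lookup (perturb I γ) j ≡ (if lookup I j then other (lookup γ j) else lookup γ j)
  lookup-perturb j = lookup∘tabulate _ j

  perturb-inside : ∀ j → lookup I j ≡ true → lookup (perturb I γ) j ≢ lookup γ j
  perturb-inside j j∈I rewrite lookup-perturb j | j∈I = other-≢ (lookup γ j)

  perturb-outside : ∀ j → lookup I j ≡ false → lookup (perturb I γ) j ≡ lookup γ j
  perturb-outside j j∉I rewrite lookup-perturb j | j∉I = refl

  perturb-differs : ∀ j → (lookup (perturb I γ) j ≢ lookup γ j) ⇔ (j ∈ I)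
  perturb-differs j = mk⇔ differs⇒∈ (λ j∈I → perturb-inside j ([]=⇒lookup j∈I))
    where
    differs⇒∈ : lookup (perturb I γ) j ≢ lookup γ j → j ∈ I
    differs⇒∈ ν≢γ with lookup I j in eq
    ... | true  = lookup⇒[]= j I eq
    ... | false = ⊥-elim (ν≢γ (perturb-outside j eq))

  dist-perturb : dist (perturb I γ) γ ≡ ∣ I ∣
  dist-perturb = trans (dist-as-∑ (perturb I γ) γ) (trans (sum-cong-≗ entrywise) (count-as-∑ I))
    where
    indicator : ∀ {n} → Subset n → Fin n → ℕ
    indicator J j = if lookup J j then 1 else 0
    entrywise : ∀ j → differ (lookup (perturb I γ) j) (lookup γ j) ≡ indicator I j
    entrywise j with lookup I j in eq
    ... | true  = differ-≢ (perturb-inside j eq)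
    ... | false = differ-≡ (perturb-outside j eq)
    count-as-∑ : ∀ {n} (J : Subset n) → ∑ (indicator J) ≡ ∣ J ∣
    count-as-∑ []          = refl
    count-as-∑ (true ∷ J)  = cong suc (count-as-∑ J)
    count-as-∑ (false ∷ J) = count-as-∑ J

dist-perturb≡ : ∀ {m q} (I : Subset m) (γ : Word m (suc (suc q))) {i} → ∣ I ∣ ≡ i → dist (perturb I γ) γ ≡ i
dist-perturb≡ I γ ∣I∣≡i = trans (dist-perturb I γ) ∣I∣≡i

perturb∈DistSet : ∀ {m q} {C : Code m (suc (suc q))} {δ i} → MinDistBound C δ → i + i < δ →
  (I : Subset m) → ∣ I ∣ ≡ i → ∀ {γ} → C γ → DistSet C i (perturb I γ)
perturb∈DistSet minDist 2i<δ I ∣I∣≡i {γ} Cγ =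
  within-packing⇒DistSet minDist 2i<δ (perturb I γ) Cγ (dist-perturb≡ I γ ∣I∣≡i)

-- An element mapping α to β and ν_α to ν_β stabilises I: it carries the
-- difference set of (ν_α, α), which is I, onto that of (ν_β, β), again I.
perturbation-stabilises : ∀ {m q} (I : Subset m) (α β : Word m (suc (suc q))) (x : Aut m (suc (suc q))) →
  perturb I α · x ≡ perturb I β → α · x ≡ β → ∀ j → (j ∈ I) ⇔ ((σ x ⟨$⟩ʳ j) ∈ I)
perturbation-stabilises {m} I α β x νx≡μ αx≡β j =
  ⇔.trans (⇔.sym (perturb-differs I α j))
  (⇔.trans (difference-transport x (perturb I α) α j)
           (subst₂ (λ u v → (lookup u k ≢ lookup v k) ⇔ (k ∈ I)) (sym νx≡μ) (sym αx≡β) (perturb-differs I β k)))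
  where
  k : Fin m
  k = σ x ⟨$⟩ʳ j

empty-stabilised : ∀ {m} {I : Subset m} → ∣ I ∣ ≡ 0 → ∀ (π : Permutation′ m) j → (j ∈ I) ⇔ ((π ⟨$⟩ʳ j) ∈ I)
empty-stabilised {I = I} ∣I∣≡0 π j = mk⇔ (λ j∈I → ⊥-elim (∉ j∈I)) (λ πj∈I → ⊥-elim (∉ πj∈I))
  where
  ∉ : ∀ {k} → k ∈ I → ⊥
  ∉ k∈I = n≮0 (subst (∣ I - _ ∣ <_) ∣I∣≡0 (x∈p⇒∣p-x∣<∣p∣ k∈I))

corollary2p6 : (m q : ℕ) → 2 ≤ q → (X : Subgroup m q) → (s : ℕ) → (C : Code m q)
    → AtLeastTwo C → NeighbourTransitive X s C
    → (δ : ℕ) → IsMinDist C δ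
    → (i : ℕ) → i ≤ s ⊓ ((δ ∸ 1) / 2)
    → (I : Subset m) → ∣ I ∣ ≡ i
    → TransitiveOn (InSetStab X I) C
corollary2p6 m .(suc (suc q)) (s≤s (s≤s {n = q} _)) X s C _ (_ , trC , _) δ _ zero _ I ∣I∣≡0 α β Cα Cβ
  with trC α β Cα Cβ
... | x , x∈X , αx≡β = x , (x∈X , empty-stabilised ∣I∣≡0 (σ x)) , αx≡β
corollary2p6 m .(suc (suc q)) (s≤s (s≤s {n = q} _)) X s C _ (stab , _ , trN) δ (_ , minDist) i@(suc _) i≤ I ∣I∣≡i α β Cα Cβ
  with packing-gap (s≤s z≤n) (m≤n⊓o⇒m≤o s ((δ ∸ 1) / 2) i≤)
... | 2i<δ with trN i (s≤s z≤n) (m≤n⊓o⇒m≤n s ((δ ∸ 1) / 2) i≤) (perturb I α) (perturb I β)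
                    (perturb∈DistSet minDist 2i<δ I ∣I∣≡i Cα) (perturb∈DistSet minDist 2i<δ I ∣I∣≡i Cβ)
... | x , x∈X , ναx≡νβ = x , (x∈X , perturbation-stabilises I α β x ναx≡νβ αx≡β) , αx≡β
  where
  αx≡β : α · x ≡ β
  αx≡β = nearest-codeword-equivariant {X = X} stab minDist 2i<δ x∈X Cα Cβ
           (perturb I α) (perturb I β)
           (ℕ.≤-reflexive (dist-perturb≡ I α ∣I∣≡i)) (ℕ.≤-reflexive (dist-perturb≡ I β ∣I∣≡i)) ναx≡νβ
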